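{- Let $G=(V,E)$ be a finite simple graph with a splitting $(G^1,G^2,\{v\})$ at an articulation $v\in V$. Then \[ D(G,x)=\mathbf u_v(G^1)^T\,\mathbf Q\,\mathbf u_v(G^2),\qquad \mathbf Q=\begin{pmatrix}1&1&0\\1&0&0\\0&0&x\end{pmatrix}. \]
   Context: The domination polynomial of a finite simple graph $H=(V,E)$ is $D(H,x)=\sum_{W\subseteq V,\ N_H[W]=V}x^{|W|}$, where $N_H[W]$ is the closed neighborhood of $W$. A splitting $(G^1,G^2,X)$ of $G$ consists of subgraphs $G^i=(V^i,E^i)$ with $V=V^1\cup V^2$, $X=V^1\cap V^2$, $E=E^1\cup E^2$ and $E^1\cap E^2=\emptyset$; when $X=\{v\}$, $v$ is an articulation. For a graph $H$ containing $v$: - $D_{v\in W}(H,x)$ (resp. $D_{v\notin W}(H,x)$) is the sum of $x^{|W|}$ over dominating sets $W$ of $H$ containing (resp. not containing) $v$. - $D_{v\notin N_H[W]}(H-v,x)$ is the sum of $x^{|W|}$ over dominating sets $W$ of $H-v$ containing no neighbor of $v$ in $H$. - $\mathbf u_v(H)=\big(D_{v\notin W}(H,x),\ D_{v\notin N_H[W]}(H-v,x),\ \tfrac1x D_{v\in W}(H,x)\big)^T$. -}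

module Defs where

open import Level using (Level)
open import Data.Bool using (Bool; true; false; _∧_; _∨_; not; if_then_else_)
open import Data.Nat using (ℕ; zero; suc; _∸_)
open import Data.Fin using (Fin)
open import Data.Fin.Subset using (Subset; ∣_∣; _-_; _∈_; _⊆_)
open import Data.Vec using (Vec; []; _∷_; lookup)
open import Data.List using (List; []; _∷_; map; _++_; foldr)
open import Data.Bool.ListAction using (all; any)
open import Data.List using () renaming (allFin to finList)
open import Relation.Binary.PropositionalEquality using (_≡_)
open import Algebra.Bundles using (CommutativeSemiring)

-- Vertices of the ambient graph are Fin n.  A (sub)graph H is given by a
-- vertex set S : Subset n and an adjacency relation A : Fin n → Fin n → Bool
-- (A u w ≡ true means uw is an edge of H).

Adj : ℕ → Set
Adj n = Fin n → Fin n → Bool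

Symmetric : ∀ {n} → Adj n → Set
Symmetric A = ∀ u w → A u w ≡ A w u

Irreflexive : ∀ {n} → Adj n → Set
Irreflexive A = ∀ u → A u u ≡ false

subsets : ∀ n → List (Subset n)
subsets zero = [] ∷ []
subsets (suc n) = map (true ∷_) (subsets n) ++ map (false ∷_) (subsets n)

mem : ∀ {n} → Fin n → Subset n → Bool
mem u W = lookup W u

subsetB : ∀ {n} → Subset n → Subset n → Bool
subsetB {n} W S = all (λ u → not (mem u W) ∨ mem u S) (finList n)

dominates : ∀ {n} → Subset n → Adj n → Subset n → Bool
dominates {n} S A W =
  subsetB W S ∧
  all (λ u → not (mem u S) ∨ (mem u W ∨ any (λ w → mem w W ∧ A w u) (finList n)))
      (finList n)

noNeighbour : ∀ {n} → Adj n → Fin n → Subset n → Bool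
noNeighbour {n} A v W = not (any (λ w → mem w W ∧ A v w) (finList n))

module _ {c ℓ : Level} (R : CommutativeSemiring c ℓ) where
  open CommutativeSemiring R

  pow : Carrier → ℕ → Carrier
  pow x zero = 1#
  pow x (suc k) = x * pow x k

  sumOver : ∀ {n} → (Subset n → Bool) → (ℕ → ℕ) → Carrier → Carrier
  sumOver {n} P f x =
    foldr (λ W acc → if P W then pow x (f ∣ W ∣) + acc else acc) 0# (subsets n)

  idℕ : ℕ → ℕ
  idℕ k = k

  Dom : ∀ {n} → Subset n → Adj n → Carrier → Carrier
  Dom S A x = sumOver (dominates S A) idℕ x

  DomNotIn : ∀ {n} → Subset n → Adj n → Fin n → Carrier → Carrier
  DomNotIn S A v x = sumOver (λ W → dominates S A W ∧ not (mem v W)) idℕ x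

  DomNotNbr : ∀ {n} → Subset n → Adj n → Fin n → Carrier → Carrier
  DomNotNbr S A v x =
    sumOver (λ W → dominates (S - v) A W ∧ noNeighbour A v W) idℕ x

  -- (1/x) D_{v∈W}(H,x) = Σ_{W dominating, v ∈ W} x^(|W| - 1)
  -- (exact polynomial division: every such W is nonempty)
  DomInDivX : ∀ {n} → Subset n → Adj n → Fin n → Carrier → Carrier
  DomInDivX S A v x =
    sumOver (λ W → dominates S A W ∧ mem v W) (λ k → k ∸ 1) x

  uVec : ∀ {n} → Subset n → Adj n → Fin n → Carrier → Fin 3 → Carrier
  uVec S A v x Fin.zero = DomNotIn S A v x
  uVec S A v x (Fin.suc Fin.zero) = DomNotNbr S A v x
  uVec S A v x (Fin.suc (Fin.suc Fin.zero)) = DomInDivX S A v x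

  Qmat : Carrier → Fin 3 → Fin 3 → Carrier
  Qmat x Fin.zero Fin.zero = 1#
  Qmat x Fin.zero (Fin.suc Fin.zero) = 1#
  Qmat x Fin.zero (Fin.suc (Fin.suc Fin.zero)) = 0#
  Qmat x (Fin.suc Fin.zero) Fin.zero = 1#
  Qmat x (Fin.suc Fin.zero) (Fin.suc Fin.zero) = 0#
  Qmat x (Fin.suc Fin.zero) (Fin.suc (Fin.suc Fin.zero)) = 0#
  Qmat x (Fin.suc (Fin.suc Fin.zero)) Fin.zero = 0#
  Qmat x (Fin.suc (Fin.suc Fin.zero)) (Fin.suc Fin.zero) = 0#
  Qmat x (Fin.suc (Fin.suc Fin.zero)) (Fin.suc (Fin.suc Fin.zero)) = x

  sum3 : (Fin 3 → Carrier) → Carrier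
  sum3 f = f Fin.zero + (f (Fin.suc Fin.zero) + f (Fin.suc (Fin.suc Fin.zero)))

  bilin : (Fin 3 → Carrier) → (Fin 3 → Fin 3 → Carrier) → (Fin 3 → Carrier) → Carrier
  bilin a M b = sum3 (λ i → sum3 (λ j → a i * (M i j * b j)))

record IsArticulationSplitting {n : ℕ} (E : Adj n) (V₁ : Subset n) (E₁ : Adj n)
         (V₂ : Subset n) (E₂ : Adj n) (v : Fin n) : Set where
  field
    E₁-sym  : Symmetric E₁
    E₂-sym  : Symmetric E₂
    E₁-in-V₁ : ∀ u w → E₁ u w ≡ true → mem u V₁ ≡ true
    E₂-in-V₂ : ∀ u w → E₂ u w ≡ true → mem u V₂ ≡ true
    cover   : ∀ u → mem u V₁ ∨ mem u V₂ ≡ true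
    meet    : ∀ u → (mem u V₁ ∧ mem u V₂ ≡ true) → u ≡ v
    v∈V₁    : mem v V₁ ≡ true
    v∈V₂    : mem v V₂ ≡ true
    edges   : ∀ u w → E u w ≡ (E₁ u w ∨ E₂ u w)
    disjoint : ∀ u w → E₁ u w ∧ E₂ u w ≡ false

module Submission where

-- A set W ⊆ V is cut by the splitting into its traces W₁ = W ∩ V¹ and
-- W₂ = W ∩ V², and W ↦ (W₁ , W₂) is a bijection onto the pairs that agree
-- on v.  Closed neighbourhoods split the same way, N_G[W] = N_G¹[W₁] ∪ N_G²[W₂],
-- so W dominates G iff each Wᵢ dominates Vⁱ - v and v is dominated on one of
-- the two sides.  Sorting the dominating sets by whether v ∈ W, and (when
-- v ∉ W) by which side dominates v, gives exactly the four products that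
-- the quadratic form uᵀ Q u′ = u₀u′₀ + u₀u′₁ + u₁u′₀ + x u₂u′₂ expands into;
-- the factor x and the shifted exponents account for v being counted in
-- both traces.

open import Defs
open import Level using (Level)
open import Data.Bool using (Bool; true; false; _∧_; _∨_; not; if_then_else_)
open import Data.Bool.Properties using (∧-comm; ∧-identityʳ; ∨-comm; not-injective; not-¬; ¬-not; T-≡)
open import Data.Bool.ListAction using (all; any)
open import Data.Nat as ℕ using (ℕ; zero; suc; _∸_; _≤_; s≤s; z≤n)
import Data.Nat.Properties as ℕₚ
open import Data.Fin using (Fin; zero; suc)
open import Data.Fin.Properties as Fin using (_≟_)
open import Data.Fin.Subset using (Subset; ⊤; _∩_; _-_; ∣_∣; ⁅_⁆)
open import Data.Fin.Subset.Properties using (p─q⊆p; x∈p∧x≢y⇒x∈p-y; x∈p⇒∣p-x∣<∣p∣; Empty-unique; ∣⊥∣≡0)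
open import Data.List using (List; []; _∷_; map; _++_; foldr)
open import Data.List using () renaming (allFin to finList)
open import Data.List.Membership.Propositional.Properties using (∈-allFin)
import Data.List.Relation.Unary.All as All
import Data.List.Relation.Unary.Any as Any
open import Data.List.Relation.Unary.All.Properties using (all⁺; all⁻)
open import Data.List.Relation.Unary.Any.Properties using (any⁺; any⁻)
open import Data.Vec using ([]; _∷_)
open import Data.Vec.Properties using (lookup-zipWith; lookup-replicate; lookup⇒[]=; []=⇒lookup)
open import Data.Product using (∃; _×_; _,_; proj₁; proj₂)
open import Data.Sum using (_⊎_; inj₁; inj₂)
open import Data.Empty using (⊥; ⊥-elim)
open import Function.Bundles using (Equivalence)
open import Relation.Binary.PropositionalEquality using (_≡_; _≢_; refl; sym; trans; cong; cong₂)
open import Relation.Nullary using (yes; no)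
open import Algebra.Bundles using (CommutativeSemiring)

∧-elim : ∀ {a b} → a ∧ b ≡ true → a ≡ true × b ≡ true
∧-elim {true} p = refl , p

∧-intro : ∀ {a b} → a ≡ true → b ≡ true → a ∧ b ≡ true
∧-intro refl refl = refl

∨-elim : ∀ {a b} → a ∨ b ≡ true → a ≡ true ⊎ b ≡ true
∨-elim {true} _ = inj₁ refl
∨-elim {false} p = inj₂ p

∨-introˡ : ∀ {a b} → a ≡ true → a ∨ b ≡ true
∨-introˡ refl = refl

∨-introʳ : ∀ {a b} → b ≡ true → a ∨ b ≡ true
∨-introʳ {true} _ = refl
∨-introʳ {false} p = p

⇒-intro : ∀ {a b} → (a ≡ true → b ≡ true) → not a ∨ b ≡ true
⇒-intro {true} f = f refl
⇒-intro {false} _ = refl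

⇒-elim : ∀ {a b} → not a ∨ b ≡ true → a ≡ true → b ≡ true
⇒-elim p refl = p

bool-ext : ∀ {a b} → (a ≡ true → b ≡ true) → (b ≡ true → a ≡ true) → a ≡ b
bool-ext {true} {true} _ _ = refl
bool-ext {true} {false} f _ = sym (f refl)
bool-ext {false} {true} _ g = g refl
bool-ext {false} {false} _ _ = refl

module _ {n : ℕ} (p : Fin n → Bool) where

  all-intro : (∀ u → p u ≡ true) → all p (finList n) ≡ true
  all-intro h = Equivalence.to T-≡ (all⁻ p {xs = finList n} (All.tabulate (λ {u} _ → Equivalence.from T-≡ (h u))))

  all-elim : all p (finList n) ≡ true → ∀ u → p u ≡ true
  all-elim h u =
    Equivalence.to T-≡ (All.lookup (all⁺ p (finList n) (Equivalence.from T-≡ h)) (∈-allFin u))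

  any-intro : ∀ u → p u ≡ true → any p (finList n) ≡ true
  any-intro u h = Equivalence.to T-≡ (any⁺ p (Any.map (λ { refl → Equivalence.from T-≡ h }) (∈-allFin u)))

  any-elim : any p (finList n) ≡ true → ∃ λ u → p u ≡ true
  any-elim h with Any.satisfied (any⁻ p (finList n) (Equivalence.from T-≡ h))
  ... | u , pu = u , Equivalence.to T-≡ pu

any-cong : ∀ {A : Set} {p q : A → Bool} (xs : List A) → (∀ a → p a ≡ q a) → any p xs ≡ any q xs
any-cong [] _ = refl
any-cong (a ∷ xs) e = cong₂ _∨_ (e a) (any-cong xs e)

SubsetOf : ∀ {n} → Subset n → Subset n → Set
SubsetOf X S = ∀ u → mem u X ≡ true → mem u S ≡ true

Covers : ∀ {n} → Subset n → Subset n → Set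
Covers V₁ V₂ = ∀ u → mem u V₁ ∨ mem u V₂ ≡ true

subsetB-sound : ∀ {n} {X S : Subset n} → subsetB X S ≡ true → SubsetOf X S
subsetB-sound {X = X} {S} h u = ⇒-elim (all-elim (λ u → not (mem u X) ∨ mem u S) h u)

subsetB-complete : ∀ {n} {X S : Subset n} → SubsetOf X S → subsetB X S ≡ true
subsetB-complete {X = X} {S} X⊆S = all-intro (λ u → not (mem u X) ∨ mem u S) (λ u → ⇒-intro (X⊆S u))

mem-∩ : ∀ {n} (u : Fin n) (X Y : Subset n) → mem u (X ∩ Y) ≡ mem u X ∧ mem u Y
mem-∩ u X Y = lookup-zipWith _∧_ u X Y

mem-⊤ : ∀ {n} (u : Fin n) → mem u ⊤ ≡ true
mem-⊤ u = lookup-replicate u true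

trace-⊆ : ∀ {n} (W V : Subset n) → SubsetOf (W ∩ V) V
trace-⊆ W V u h = proj₂ (∧-elim (trans (sym (mem-∩ u W V)) h))

trace-⊆-set : ∀ {n} (W V : Subset n) → SubsetOf (W ∩ V) W
trace-⊆-set W V u h = proj₁ (∧-elim (trans (sym (mem-∩ u W V)) h))

trace-intro : ∀ {n} {u : Fin n} (W V : Subset n) → mem u W ≡ true → mem u V ≡ true → mem u (W ∩ V) ≡ true
trace-intro {u = u} W V p q = trans (mem-∩ u W V) (∧-intro p q)

mem-trace : ∀ {n} {u : Fin n} (W V : Subset n) → mem u V ≡ true → mem u (W ∩ V) ≡ mem u W
mem-trace {u = u} W V u∈V = trans (mem-∩ u W V) (trans (cong (mem u W ∧_) u∈V) (∧-identityʳ _))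

mem-minus-self : ∀ {n} (S : Subset n) v → mem v (S - v) ≡ false
mem-minus-self (_ ∷ S) zero = refl
mem-minus-self (_ ∷ S) (suc v) = mem-minus-self S v

mem-minus-⊆ : ∀ {n} (S : Subset n) v → SubsetOf (S - v) S
mem-minus-⊆ S v u h = []=⇒lookup (p─q⊆p S ⁅ v ⁆ (lookup⇒[]= u (S - v) h))

mem-minus-≢ : ∀ {n} (S : Subset n) {v u} → mem u (S - v) ≡ true → u ≢ v
mem-minus-≢ S {v} h refl = not-¬ h (mem-minus-self S v)

mem-minus-intro : ∀ {n} (S : Subset n) {v u} → mem u S ≡ true → u ≢ v → mem u (S - v) ≡ true
mem-minus-intro S {u = u} h u≢v = []=⇒lookup (x∈p∧x≢y⇒x∈p-y (lookup⇒[]= u S h) u≢v)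

subsetB-minus : ∀ {n} {X S : Subset n} {v} → SubsetOf X S → subsetB X (S - v) ≡ not (mem v X)
subsetB-minus {X = X} {S} {v} X⊆S = bool-ext to from
  where
  to : subsetB X (S - v) ≡ true → not (mem v X) ≡ true
  to h = cong not (¬-not (λ v∈X → not-¬ (subsetB-sound {X = X} {S - v} h v v∈X) (mem-minus-self S v)))
  from : not (mem v X) ≡ true → subsetB X (S - v) ≡ true
  from h = subsetB-complete {X = X} {S - v} (λ u u∈X → mem-minus-intro S {v} (X⊆S u u∈X)
             (λ { refl → not-¬ u∈X (not-injective h) }))

trace-size-sum : ∀ {n} (W V₁ V₂ : Subset n) → Covers V₁ V₂ →
  ∣ W ∩ V₁ ∣ ℕ.+ ∣ W ∩ V₂ ∣ ≡ ∣ W ∣ ℕ.+ ∣ W ∩ (V₁ ∩ V₂) ∣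
trace-size-sum [] [] [] _ = refl
trace-size-sum (false ∷ W) (_ ∷ V₁) (_ ∷ V₂) c = trace-size-sum W V₁ V₂ (λ u → c (suc u))
trace-size-sum (true ∷ W) (true ∷ V₁) (true ∷ V₂) c = cong suc (begin
    ∣ W ∩ V₁ ∣ ℕ.+ suc ∣ W ∩ V₂ ∣        ≡⟨ ℕₚ.+-suc ∣ W ∩ V₁ ∣ ∣ W ∩ V₂ ∣ ⟩
    suc (∣ W ∩ V₁ ∣ ℕ.+ ∣ W ∩ V₂ ∣)      ≡⟨ cong suc (trace-size-sum W V₁ V₂ (λ u → c (suc u))) ⟩
    suc (∣ W ∣ ℕ.+ ∣ W ∩ (V₁ ∩ V₂) ∣)    ≡⟨ ℕₚ.+-suc ∣ W ∣ ∣ W ∩ (V₁ ∩ V₂) ∣ ⟨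
    ∣ W ∣ ℕ.+ suc ∣ W ∩ (V₁ ∩ V₂) ∣      ∎)
  where open Relation.Binary.PropositionalEquality.≡-Reasoning
trace-size-sum (true ∷ W) (true ∷ V₁) (false ∷ V₂) c = cong suc (trace-size-sum W V₁ V₂ (λ u → c (suc u)))
trace-size-sum (true ∷ W) (false ∷ V₁) (true ∷ V₂) c =
  trans (ℕₚ.+-suc ∣ W ∩ V₁ ∣ ∣ W ∩ V₂ ∣) (cong suc (trace-size-sum W V₁ V₂ (λ u → c (suc u))))
trace-size-sum (true ∷ W) (false ∷ V₁) (false ∷ V₂) c with c zero
... | ()

size-empty : ∀ {n} (S : Subset n) → (∀ u → mem u S ≢ true) → ∣ S ∣ ≡ 0
size-empty {n} S h = trans (cong ∣_∣ (Empty-unique (λ { (u , u∈S) → h u ([]=⇒lookup {xs = S} u∈S) }))) (∣⊥∣≡0 n)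

size-⊆-singleton : ∀ {n} (S : Subset n) v → (∀ u → mem u S ≡ true → u ≡ v) →
  ∣ S ∣ ≡ (if mem v S then 1 else 0)
size-⊆-singleton (true ∷ S) zero h = cong suc (size-empty S (λ u p → Fin.0≢1+n (sym (h (suc u) p))))
size-⊆-singleton (false ∷ S) zero h = size-empty S (λ u p → Fin.0≢1+n (sym (h (suc u) p)))
size-⊆-singleton (true ∷ S) (suc v) h with h zero refl
... | ()
size-⊆-singleton (false ∷ S) (suc v) h = size-⊆-singleton S v (λ u p → Fin.suc-injective (h (suc u) p))

nonempty-size : ∀ {n} (S : Subset n) {u} → mem u S ≡ true → 1 ≤ ∣ S ∣
nonempty-size S {u} h = ℕₚ.≤-trans (s≤s z≤n) (x∈p⇒∣p-x∣<∣p∣ {p = S} (lookup⇒[]= u S h))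

inClosedNbhd : ∀ {n} → Adj n → Subset n → Fin n → Bool
inClosedNbhd {n} A X u = mem u X ∨ any (λ w → mem w X ∧ A w u) (finList n)

dominatesExcept : ∀ {n} → Subset n → Adj n → Fin n → Subset n → Bool
dominatesExcept {n} S A v X = all (λ u → not (mem u (S - v)) ∨ inClosedNbhd A X u) (finList n)

nbhd-mono : ∀ {n} {A A′ : Adj n} {X X′ : Subset n} {u} → SubsetOf X′ X →
  (∀ w u → A′ w u ≡ true → A w u ≡ true) → inClosedNbhd A′ X′ u ≡ true → inClosedNbhd A X u ≡ true
nbhd-mono {A = A} {A′} {X} {X′} {u} X′⊆X A′⊆A h with ∨-elim {mem u X′} h
... | inj₁ u∈X′ = ∨-introˡ (X′⊆X u u∈X′)
... | inj₂ p with any-elim (λ w → mem w X′ ∧ A′ w u) p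
...   | w , q with ∧-elim {mem w X′} q
...     | w∈X′ , e = ∨-introʳ {mem u X} (any-intro (λ w → mem w X ∧ A w u) w (∧-intro (X′⊆X w w∈X′) (A′⊆A w u e)))

nbhd-within : ∀ {n} {A : Adj n} {S X : Subset n} {u} → Symmetric A →
  (∀ u w → A u w ≡ true → mem u S ≡ true) → SubsetOf X S → inClosedNbhd A X u ≡ true → mem u S ≡ true
nbhd-within {A = A} {S} {X} {u} A-sym A⊆S X⊆S h with ∨-elim {mem u X} h
... | inj₁ u∈X = X⊆S u u∈X
... | inj₂ p with any-elim (λ w → mem w X ∧ A w u) p
...   | w , q = A⊆S u w (trans (A-sym u w) (proj₂ (∧-elim {mem w X} q)))

dominates-at : ∀ {n} {S : Subset n} {A : Adj n} {v X} → SubsetOf X S → mem v S ≡ true →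
  dominates S A X ≡ dominatesExcept S A v X ∧ inClosedNbhd A X v
dominates-at {n} {S} {A} {v} {X} X⊆S v∈S =
  trans (cong (_∧ all covered (finList n)) (subsetB-complete {X = X} {S} X⊆S)) (bool-ext to from)
  where
  covered : Fin n → Bool
  covered u = not (mem u S) ∨ inClosedNbhd A X u
  to : all covered (finList n) ≡ true → dominatesExcept S A v X ∧ inClosedNbhd A X v ≡ true
  to h = ∧-intro (all-intro _ (λ u → ⇒-intro (λ u∈S-v → ⇒-elim (all-elim covered h u) (mem-minus-⊆ S v u u∈S-v))))
                 (⇒-elim (all-elim covered h v) v∈S)
  from : dominatesExcept S A v X ∧ inClosedNbhd A X v ≡ true → all covered (finList n) ≡ true
  from h = all-intro covered (λ u → ⇒-intro (covers u))
    where
    covers : ∀ u → mem u S ≡ true → inClosedNbhd A X u ≡ true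
    covers u u∈S with u ≟ v
    ... | yes refl = proj₂ (∧-elim h)
    ... | no u≢v = ⇒-elim (all-elim _ (proj₁ (∧-elim h)) u) (mem-minus-intro S u∈S u≢v)

dominates-minus : ∀ {n} {S : Subset n} {A : Adj n} {v X} → Symmetric A → SubsetOf X S →
  dominates (S - v) A X ∧ noNeighbour A v X
    ≡ not (mem v X) ∧ (dominatesExcept S A v X ∧ not (inClosedNbhd A X v))
dominates-minus {n} {S} {A} {v} {X} A-sym X⊆S =
  trans (cong₂ _∧_ (cong (_∧ dominatesExcept S A v X) (subsetB-minus {X = X} {S} {v} X⊆S))
                (cong not (any-cong (finList n) (λ w → cong (mem w X ∧_) (A-sym v w)))))
        (regroup (mem v X) (dominatesExcept S A v X) _)
  where
  regroup : ∀ m a e → (not m ∧ a) ∧ not e ≡ not m ∧ (a ∧ not (m ∨ e))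
  regroup true _ _ = refl
  regroup false _ _ = refl

contributes : ∀ {n} → Subset n → Adj n → Fin n → Fin 3 → Subset n → Bool
contributes S A v zero X = dominates S A X ∧ not (mem v X)
contributes S A v (suc zero) X = dominates (S - v) A X ∧ noNeighbour A v X
contributes S A v (suc (suc zero)) X = dominates S A X ∧ mem v X

containsV : Fin 3 → Bool
containsV zero = false
containsV (suc zero) = false
containsV (suc (suc zero)) = true

exponentAt : Fin 3 → ℕ → ℕ
exponentAt zero k = k
exponentAt (suc zero) k = k
exponentAt (suc (suc zero)) k = k ∸ 1

-- The contribution conditions in terms of a = "X dominates S - v",
-- b = "v ∈ N[X]" and m = "v ∈ X".
sideCondition : Bool → Bool → Bool → Fin 3 → Bool
sideCondition a b m zero = not m ∧ (a ∧ b)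
sideCondition a b m (suc zero) = not m ∧ (a ∧ not b)
sideCondition a b m (suc (suc zero)) = m ∧ (a ∧ b)

contributes-decomposed : ∀ {n} {S : Subset n} {A : Adj n} {v X} → Symmetric A → SubsetOf X S →
  mem v S ≡ true → ∀ i →
  contributes S A v i X ≡ sideCondition (dominatesExcept S A v X) (inClosedNbhd A X v) (mem v X) i
contributes-decomposed {S = S} {A} {v} {X} _ X⊆S v∈S zero =
  trans (cong (_∧ not (mem v X)) (dominates-at {S = S} {A} {v} {X} X⊆S v∈S))
        (∧-comm (dominatesExcept S A v X ∧ inClosedNbhd A X v) _)
contributes-decomposed {S = S} {A} {v} {X} A-sym X⊆S _ (suc zero) =
  dominates-minus {S = S} {A} {v} {X} A-sym X⊆S
contributes-decomposed {S = S} {A} {v} {X} _ X⊆S v∈S (suc (suc zero)) =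
  trans (cong (_∧ mem v X) (dominates-at {S = S} {A} {v} {X} X⊆S v∈S))
        (∧-comm (dominatesExcept S A v X ∧ inClosedNbhd A X v) _)

contributes-support : ∀ {n} {S : Subset n} {A : Adj n} {v X} i →
  contributes S A v i X ≡ true → SubsetOf X S × mem v X ≡ containsV i
contributes-support {S = S} {A} {v} {X} zero h with ∧-elim {dominates S A X} h
... | d , v∉X = subsetB-sound {X = X} {S} (proj₁ (∧-elim d)) , not-injective v∉X
contributes-support {S = S} {A} {v} {X} (suc zero) h =
  (λ u u∈X → mem-minus-⊆ S v u (X⊆S-v u u∈X)) , ¬-not (λ v∈X → not-¬ (X⊆S-v v v∈X) (mem-minus-self S v))
  where
  X⊆S-v : SubsetOf X (S - v)
  X⊆S-v = subsetB-sound {X = X} {S - v} (proj₁ (∧-elim (proj₁ (∧-elim {dominates (S - v) A X} h))))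
contributes-support {S = S} {A} {v} {X} (suc (suc zero)) h with ∧-elim {dominates S A X} h
... | d , v∈X = subsetB-sound {X = X} {S} (proj₁ (∧-elim d)) , v∈X

open IsArticulationSplitting

-- A splitting read the other way round is again a splitting; this lets
-- every lemma proved for the first side be used for the second.
swap : ∀ {n} {E : Adj n} {V₁ E₁ V₂ E₂ v} → IsArticulationSplitting E V₁ E₁ V₂ E₂ v →
  IsArticulationSplitting E V₂ E₂ V₁ E₁ v
swap {V₁ = V₁} {E₁} {V₂} {E₂} split = record
  { E₁-sym = E₂-sym split ; E₂-sym = E₁-sym split
  ; E₁-in-V₁ = E₂-in-V₂ split ; E₂-in-V₂ = E₁-in-V₁ split
  ; cover = λ u → trans (∨-comm (mem u V₂) (mem u V₁)) (cover split u)
  ; meet = λ u h → meet split u (trans (∧-comm (mem u V₁) (mem u V₂)) h)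
  ; v∈V₁ = v∈V₂ split ; v∈V₂ = v∈V₁ split
  ; edges = λ u w → trans (edges split u w) (∨-comm (E₁ u w) (E₂ u w))
  ; disjoint = λ u w → trans (∧-comm (E₂ u w) (E₁ u w)) (disjoint split u w) }

neighbour-in-trace : ∀ {n} (A : Adj n) (W V : Subset n) {w u} →
  mem w W ≡ true → mem w V ≡ true → A w u ≡ true → inClosedNbhd A (W ∩ V) u ≡ true
neighbour-in-trace A W V {w} {u} w∈W w∈V e =
  ∨-introʳ {mem u (W ∩ V)} (any-intro (λ w → mem w (W ∩ V) ∧ A w u) w (∧-intro (trace-intro W V w∈W w∈V) e))

-- N_G[W] = N_G¹[W ∩ V¹] ∪ N_G²[W ∩ V²]: the inclusion ⊆ (a neighbour in W
-- is joined to u by an edge of one side, and lies on that side) ...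
nbhd-union : ∀ {n} {E : Adj n} {V₁ E₁ V₂ E₂ v} → IsArticulationSplitting E V₁ E₁ V₂ E₂ v →
  ∀ W {u} → inClosedNbhd E W u ≡ true →
  inClosedNbhd E₁ (W ∩ V₁) u ≡ true ⊎ inClosedNbhd E₂ (W ∩ V₂) u ≡ true
nbhd-union {E = E} {V₁} {E₁} {V₂} {E₂} split W {u} h with ∨-elim {mem u W} h
... | inj₁ u∈W with ∨-elim (cover split u)
...   | inj₁ u∈V₁ = inj₁ (∨-introˡ (trace-intro W V₁ u∈W u∈V₁))
...   | inj₂ u∈V₂ = inj₂ (∨-introˡ (trace-intro W V₂ u∈W u∈V₂))
nbhd-union {E = E} {V₁} {E₁} {V₂} {E₂} split W {u} h | inj₂ p
  with any-elim (λ w → mem w W ∧ E w u) p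
... | w , q with ∧-elim {mem w W} q
...   | w∈W , e with ∨-elim {E₁ w u} (trans (sym (edges split w u)) e)
...     | inj₁ e₁ = inj₁ (neighbour-in-trace E₁ W V₁ w∈W (E₁-in-V₁ split w u e₁) e₁)
...     | inj₂ e₂ = inj₂ (neighbour-in-trace E₂ W V₂ w∈W (E₂-in-V₂ split w u e₂) e₂)

nbhd-extend : ∀ {n} {E : Adj n} {V₁ E₁ V₂ E₂ v} → IsArticulationSplitting E V₁ E₁ V₂ E₂ v →
  ∀ W {u} → inClosedNbhd E₁ (W ∩ V₁) u ≡ true → inClosedNbhd E W u ≡ true
nbhd-extend {E = E} {V₁} {E₁} {E₂ = E₂} split W =
  nbhd-mono {A = E} {E₁} {W} {W ∩ V₁} (trace-⊆-set W V₁) (λ w u e → trans (edges split w u) (∨-introˡ {E₁ w u} {E₂ w u} e))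

nbhd-restrict : ∀ {n} {E : Adj n} {V₁ E₁ V₂ E₂ v} → IsArticulationSplitting E V₁ E₁ V₂ E₂ v →
  ∀ W {u} → mem u V₁ ≡ true → u ≢ v → inClosedNbhd E W u ≡ true → inClosedNbhd E₁ (W ∩ V₁) u ≡ true
nbhd-restrict {V₂ = V₂} {E₂} split W {u} u∈V₁ u≢v h with nbhd-union split W h
... | inj₁ h₁ = h₁
... | inj₂ h₂ =
  ⊥-elim (u≢v (meet split u (∧-intro u∈V₁
    (nbhd-within {A = E₂} {V₂} {W ∩ V₂} (E₂-sym split) (E₂-in-V₂ split) (trace-⊆ W V₂) h₂))))

dominates-glued : ∀ {n} {E : Adj n} {V₁ E₁ V₂ E₂ v} → IsArticulationSplitting E V₁ E₁ V₂ E₂ v →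
  ∀ W → dominates ⊤ E W ≡
    (dominatesExcept V₁ E₁ v (W ∩ V₁) ∧ dominatesExcept V₂ E₂ v (W ∩ V₂)) ∧
    (inClosedNbhd E₁ (W ∩ V₁) v ∨ inClosedNbhd E₂ (W ∩ V₂) v)
dominates-glued {n} {E} {V₁} {E₁} {V₂} {E₂} {v} split W =
  trans (cong (_∧ all covered (finList n)) (subsetB-complete {X = W} {⊤} (λ u _ → mem-⊤ u)))
        (bool-ext to from)
  where
  covered : Fin n → Bool
  covered u = not (mem u ⊤) ∨ inClosedNbhd E W u

  a₁ a₂ b₁ b₂ : Bool
  a₁ = dominatesExcept V₁ E₁ v (W ∩ V₁)
  a₂ = dominatesExcept V₂ E₂ v (W ∩ V₂)
  b₁ = inClosedNbhd E₁ (W ∩ V₁) v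
  b₂ = inClosedNbhd E₂ (W ∩ V₂) v

  restrictExcept : ∀ {V E′ V′ E″} → IsArticulationSplitting E V E′ V′ E″ v →
    (∀ u → inClosedNbhd E W u ≡ true) → dominatesExcept V E′ v (W ∩ V) ≡ true
  restrictExcept {V} s N = all-intro _ (λ u → ⇒-intro (λ u∈V-v →
    nbhd-restrict s W (mem-minus-⊆ V v u u∈V-v) (mem-minus-≢ V u∈V-v) (N u)))

  extendExcept : ∀ {V E′ V′ E″} → IsArticulationSplitting E V E′ V′ E″ v →
    dominatesExcept V E′ v (W ∩ V) ≡ true → ∀ {u} → mem u V ≡ true → u ≢ v → inClosedNbhd E W u ≡ true
  extendExcept {V} s a {u} u∈V u≢v =
    nbhd-extend s W (⇒-elim (all-elim _ a u) (mem-minus-intro V u∈V u≢v))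

  to : all covered (finList n) ≡ true → (a₁ ∧ a₂) ∧ (b₁ ∨ b₂) ≡ true
  to h = ∧-intro (∧-intro (restrictExcept split N) (restrictExcept (swap split) N)) dominated-v
    where
    N : ∀ u → inClosedNbhd E W u ≡ true
    N u = ⇒-elim (all-elim covered h u) (mem-⊤ u)
    dominated-v : b₁ ∨ b₂ ≡ true
    dominated-v with nbhd-union split W (N v)
    ... | inj₁ h₁ = ∨-introˡ h₁
    ... | inj₂ h₂ = ∨-introʳ {b₁} h₂

  from : (a₁ ∧ a₂) ∧ (b₁ ∨ b₂) ≡ true → all covered (finList n) ≡ true
  from h = all-intro covered (λ u → ⇒-intro {mem u ⊤} (λ _ → N u))
    where
    a₁a₂ : a₁ ∧ a₂ ≡ true
    a₁a₂ = proj₁ (∧-elim h)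
    N : ∀ u → inClosedNbhd E W u ≡ true
    N u with u ≟ v
    N u | yes refl with ∨-elim {b₁} (proj₂ (∧-elim {a₁ ∧ a₂} h))
    ... | inj₁ dominated₁ = nbhd-extend split W dominated₁
    ... | inj₂ dominated₂ = nbhd-extend (swap split) W dominated₂
    N u | no u≢v with ∨-elim {mem u V₁} (cover split u)
    ... | inj₁ u∈V₁ = extendExcept split (proj₁ (∧-elim a₁a₂)) u∈V₁ u≢v
    ... | inj₂ u∈V₂ = extendExcept (swap split) (proj₂ (∧-elim {a₁} a₁a₂)) u∈V₂ u≢v

trace-sizes : ∀ {n} {E : Adj n} {V₁ E₁ V₂ E₂ v} → IsArticulationSplitting E V₁ E₁ V₂ E₂ v →
  ∀ W → ∣ W ∩ V₁ ∣ ℕ.+ ∣ W ∩ V₂ ∣ ≡ ∣ W ∣ ℕ.+ (if mem v W then 1 else 0)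
trace-sizes {V₁ = V₁} {V₂ = V₂} {v = v} split W =
  trans (trace-size-sum W V₁ V₂ (cover split))
        (cong (∣ W ∣ ℕ.+_) (trans (size-⊆-singleton (W ∩ (V₁ ∩ V₂)) v only-v)
                                (cong (λ b → if b then 1 else 0) (mem-trace W (V₁ ∩ V₂) v∈V₁∩V₂))))
  where
  only-v : ∀ u → mem u (W ∩ (V₁ ∩ V₂)) ≡ true → u ≡ v
  only-v u h = meet split u (trans (sym (mem-∩ u V₁ V₂)) (trace-⊆ W (V₁ ∩ V₂) u h))
  v∈V₁∩V₂ : mem v (V₁ ∩ V₂) ≡ true
  v∈V₁∩V₂ = trace-intro V₁ V₂ (v∈V₁ split) (v∈V₂ split)

-- `glues V₁ V₂ X Y`: X = W ∩ V₁ and Y = W ∩ V₂ for some W, checked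
-- coordinatewise: a vertex of both sides is in X iff it is in Y, and a
-- vertex of only one side is not in the trace on the other.

glueBit : Bool → Bool → Bool → Bool → Bool
glueBit true true true true = true
glueBit true true false false = true
glueBit true true _ _ = false
glueBit true false _ y = not y
glueBit false true x _ = not x
glueBit false false x y = not x ∧ not y

glues : ∀ {n} → Subset n → Subset n → Subset n → Subset n → Bool
glues [] [] [] [] = true
glues (a₁ ∷ V₁) (a₂ ∷ V₂) (x ∷ X) (y ∷ Y) = glueBit a₁ a₂ x y ∧ glues V₁ V₂ X Y

glues-pointwise : ∀ {n} (V₁ V₂ X Y : Subset n) →
  (∀ u → glueBit (mem u V₁) (mem u V₂) (mem u X) (mem u Y) ≡ true) → glues V₁ V₂ X Y ≡ true
glues-pointwise [] [] [] [] _ = refl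
glues-pointwise (_ ∷ V₁) (_ ∷ V₂) (_ ∷ X) (_ ∷ Y) h =
  ∧-intro (h zero) (glues-pointwise V₁ V₂ X Y (λ u → h (suc u)))

glues-intro : ∀ {n} {E : Adj n} {V₁ E₁ V₂ E₂ v} → IsArticulationSplitting E V₁ E₁ V₂ E₂ v →
  ∀ {X Y} → SubsetOf X V₁ → SubsetOf Y V₂ → mem v X ≡ mem v Y → glues V₁ V₂ X Y ≡ true
glues-intro {V₁ = V₁} {V₂ = V₂} {v = v} split {X} {Y} X⊆V₁ Y⊆V₂ same-v = glues-pointwise V₁ V₂ X Y at
  where
  diagonal : ∀ {x y} → x ≡ y → glueBit true true x y ≡ true
  diagonal {true} refl = refl
  diagonal {false} refl = refl
  outside : ∀ {Z V} u → SubsetOf Z V → mem u V ≡ false → not (mem u Z) ≡ true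
  outside {Z} u Z⊆V u∉V = cong not (¬-not (λ u∈Z → not-¬ (Z⊆V u u∈Z) u∉V))
  at : ∀ u → glueBit (mem u V₁) (mem u V₂) (mem u X) (mem u Y) ≡ true
  at u with mem u V₁ in e₁ | mem u V₂ in e₂
  ... | true | true with meet split u (∧-intro e₁ e₂)
  ...   | refl = diagonal same-v
  at u | true | false = outside {Y} {V₂} u Y⊆V₂ e₂
  at u | false | true = outside {X} {V₁} u X⊆V₁ e₁
  at u | false | false with trans (sym (cong₂ _∨_ e₁ e₂)) (cover split u)
  ... | ()

-- Sums over subsets in a commutative semiring.  A boolean condition enters
-- a sum through its indicator χ, which turns conjunctions into products.

module Sums {c ℓ : Level} (R : CommutativeSemiring c ℓ) where
  open CommutativeSemiring R hiding (zero) renaming (refl to ≈-refl; sym to ≈-sym; trans to ≈-trans)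
  open import Relation.Binary.Reasoning.Setoid setoid
  open import Algebra.Solver.Ring.NaturalCoefficients.Default R

  χ : Bool → Carrier
  χ true = 1#
  χ false = 0#

  χ-∧ : ∀ a b → χ (a ∧ b) ≈ χ a * χ b
  χ-∧ true b = ≈-sym (*-identityˡ (χ b))
  χ-∧ false b = ≈-sym (zeroˡ (χ b))

  -- a ∨ b holds in exactly one of three disjoint ways.
  χ-∨ : ∀ a b → χ (a ∨ b) ≈ χ a * χ b + (χ a * χ (not b) + χ (not a) * χ b)
  χ-∨ true true = solve 0 (con 1 := con 1 :* con 1 :+ (con 1 :* con 0 :+ con 0 :* con 1)) ≈-refl
  χ-∨ true false = solve 0 (con 1 := con 1 :* con 0 :+ (con 1 :* con 1 :+ con 0 :* con 0)) ≈-refl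
  χ-∨ false true = solve 0 (con 1 := con 0 :* con 1 :+ (con 0 :* con 0 :+ con 1 :* con 1)) ≈-refl
  χ-∨ false false = solve 0 (con 0 := con 0 :* con 0 :+ (con 0 :* con 1 :+ con 1 :* con 0)) ≈-refl

  χ-exclusive : ∀ {a b} → (a ≡ true → b ≡ true → ⊥) → ∀ p q → (χ a * p) * (χ b * q) ≈ 0#
  χ-exclusive {true} {true} incompatible p q = ⊥-elim (incompatible refl refl)
  χ-exclusive {true} {false} _ p q = ≈-trans (*-congˡ (zeroˡ q)) (zeroʳ _)
  χ-exclusive {false} _ p q = ≈-trans (*-congʳ (zeroˡ p)) (zeroˡ _)

  pow-+ : ∀ x a b → pow R x (a ℕ.+ b) ≈ pow R x a * pow R x b
  pow-+ x zero b = ≈-sym (*-identityˡ _)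
  pow-+ x (suc a) b = ≈-trans (*-congˡ (pow-+ x a b)) (≈-sym (*-assoc _ _ _))

  sumList : ∀ {A : Set} → List A → (A → Carrier) → Carrier
  sumList [] f = 0#
  sumList (a ∷ as) f = f a + sumList as f

  module _ {A : Set} where

    sumList-cong : ∀ (as : List A) {f g} → (∀ a → f a ≈ g a) → sumList as f ≈ sumList as g
    sumList-cong [] _ = ≈-refl
    sumList-cong (a ∷ as) e = +-cong (e a) (sumList-cong as e)

    sumList-++ : ∀ (as bs : List A) f → sumList (as ++ bs) f ≈ sumList as f + sumList bs f
    sumList-++ [] bs f = ≈-sym (+-identityˡ _)
    sumList-++ (a ∷ as) bs f = ≈-trans (+-congˡ (sumList-++ as bs f)) (≈-sym (+-assoc _ _ _))

    sumList-map : ∀ {B : Set} (h : B → A) (bs : List B) f → sumList (map h bs) f ≡ sumList bs (λ b → f (h b))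
    sumList-map h [] f = refl
    sumList-map h (b ∷ bs) f = cong (f (h b) +_) (sumList-map h bs f)

    sumList-+ : ∀ (as : List A) f g → sumList as (λ a → f a + g a) ≈ sumList as f + sumList as g
    sumList-+ [] f g = ≈-sym (+-identityˡ 0#)
    sumList-+ (a ∷ as) f g = ≈-trans (+-congˡ (sumList-+ as f g))
      (solve 4 (λ p q r s → (p :+ q) :+ (r :+ s) := (p :+ r) :+ (q :+ s)) ≈-refl _ _ _ _)

    sumList-*ˡ : ∀ (as : List A) p f → sumList as (λ a → p * f a) ≈ p * sumList as f
    sumList-*ˡ [] p f = ≈-sym (zeroʳ p)
    sumList-*ˡ (a ∷ as) p f = ≈-trans (+-congˡ (sumList-*ˡ as p f)) (≈-sym (distribˡ p _ _))

    sumList-*ʳ : ∀ (as : List A) p f → sumList as (λ a → f a * p) ≈ sumList as f * p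
    sumList-*ʳ [] p f = ≈-sym (zeroˡ p)
    sumList-*ʳ (a ∷ as) p f = ≈-trans (+-congˡ (sumList-*ʳ as p f)) (≈-sym (distribʳ p _ _))

    sumList-zero : ∀ (as : List A) {f} → (∀ a → f a ≈ 0#) → sumList as f ≈ 0#
    sumList-zero as e = ≈-trans (sumList-cong as e) (zeros as)
      where
      zeros : ∀ (as : List A) → sumList as (λ _ → 0#) ≈ 0#
      zeros [] = ≈-refl
      zeros (_ ∷ as) = ≈-trans (+-congˡ (zeros as)) (+-identityˡ 0#)

    foldr-as-sum : ∀ (P : A → Bool) (t : A → Carrier) as →
      foldr (λ a acc → if P a then t a + acc else acc) 0# as ≈ sumList as (λ a → χ (P a) * t a)
    foldr-as-sum P t [] = ≈-refl
    foldr-as-sum P t (a ∷ as) with P a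
    ... | true = +-cong (≈-sym (*-identityˡ (t a))) (foldr-as-sum P t as)
    ... | false = ≈-trans (foldr-as-sum P t as) (≈-sym (≈-trans (+-congʳ (zeroˡ (t a))) (+-identityˡ _)))

  sumSubsets : ∀ {n} → (Subset n → Carrier) → Carrier
  sumSubsets {n} = sumList (subsets n)

  sumPairs : ∀ {n} → (Subset n → Subset n → Carrier) → Carrier
  sumPairs K = sumSubsets (λ X → sumSubsets (λ Y → K X Y))

  sumOver-as-sum : ∀ {n} (P : Subset n → Bool) f x →
    sumOver R P f x ≈ sumSubsets (λ W → χ (P W) * pow R x (f ∣ W ∣))
  sumOver-as-sum {n} P f x = foldr-as-sum P (λ W → pow R x (f ∣ W ∣)) (subsets n)

  sumSubsets-suc : ∀ {n} (g : Subset (suc n) → Carrier) →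
    sumSubsets g ≈ sumSubsets (λ W → g (true ∷ W)) + sumSubsets (λ W → g (false ∷ W))
  sumSubsets-suc {n} g = ≈-trans (sumList-++ (map (true ∷_) (subsets n)) _ g)
    (+-cong (reflexive (sumList-map _ (subsets n) g)) (reflexive (sumList-map _ (subsets n) g)))

  sumPairs-cong : ∀ {n} {K L : Subset n → Subset n → Carrier} → (∀ X Y → K X Y ≈ L X Y) → sumPairs K ≈ sumPairs L
  sumPairs-cong {n} e = sumList-cong (subsets n) (λ X → sumList-cong (subsets n) (e X))

  sumPairs-zero : ∀ {n} {K : Subset n → Subset n → Carrier} → (∀ X Y → K X Y ≈ 0#) → sumPairs K ≈ 0#
  sumPairs-zero {n} e = sumList-zero (subsets n) (λ X → sumList-zero (subsets n) (e X))

  sumPairs-+ : ∀ {n} (K L : Subset n → Subset n → Carrier) → sumPairs (λ X Y → K X Y + L X Y) ≈ sumPairs K + sumPairs L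
  sumPairs-+ {n} K L = ≈-trans (sumList-cong (subsets n) (λ X → sumList-+ (subsets n) (K X) (L X)))
                               (sumList-+ (subsets n) (λ X → sumSubsets (K X)) (λ X → sumSubsets (L X)))

  sumPairs-*ˡ : ∀ {n} p (K : Subset n → Subset n → Carrier) → sumPairs (λ X Y → p * K X Y) ≈ p * sumPairs K
  sumPairs-*ˡ {n} p K = ≈-trans (sumList-cong (subsets n) (λ X → sumList-*ˡ (subsets n) p (K X)))
                                (sumList-*ˡ (subsets n) p (λ X → sumSubsets (K X)))

  sumSubsets-product : ∀ {n} (g h : Subset n → Carrier) → sumSubsets g * sumSubsets h ≈ sumPairs (λ X Y → g X * h Y)
  sumSubsets-product {n} g h = ≈-sym (≈-trans (sumList-cong (subsets n) (λ X → sumList-*ˡ (subsets n) (g X) h))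
                                              (sumList-*ʳ (subsets n) (sumSubsets h) g))

  sumPairs-suc : ∀ {n} (K : Subset (suc n) → Subset (suc n) → Carrier) →
    sumPairs K ≈ (sumPairs (λ X Y → K (true ∷ X) (true ∷ Y)) + sumPairs (λ X Y → K (true ∷ X) (false ∷ Y)))
               + (sumPairs (λ X Y → K (false ∷ X) (true ∷ Y)) + sumPairs (λ X Y → K (false ∷ X) (false ∷ Y)))
  sumPairs-suc {n} K = ≈-trans (sumSubsets-suc (λ X → sumSubsets (K X)))
    (+-cong (splitSecond true) (splitSecond false))
    where
    splitSecond : ∀ b → sumSubsets (λ X → sumSubsets (K (b ∷ X)))
      ≈ sumPairs (λ X Y → K (b ∷ X) (true ∷ Y)) + sumPairs (λ X Y → K (b ∷ X) (false ∷ Y))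
    splitSecond b = ≈-trans (sumList-cong (subsets n) (λ X → sumSubsets-suc (K (b ∷ X))))
      (sumList-+ (subsets n) (λ X → sumSubsets (λ Y → K (b ∷ X) (true ∷ Y)))
                             (λ X → sumSubsets (λ Y → K (b ∷ X) (false ∷ Y))))

  glue-sum : ∀ {n} (V₁ V₂ : Subset n) → Covers V₁ V₂ → (H : Subset n → Subset n → Carrier) →
    sumPairs (λ X Y → χ (glues V₁ V₂ X Y) * H X Y) ≈ sumSubsets (λ W → H (W ∩ V₁) (W ∩ V₂))
  glue-sum [] [] _ H = +-congʳ (≈-trans (+-congʳ (*-identityˡ _)) (+-identityʳ _))
  glue-sum {suc n} (true ∷ V₁) (true ∷ V₂) cov H = begin
    _ ≈⟨ sumPairs-suc {n} (λ X Y → χ (glues (true ∷ V₁) (true ∷ V₂) X Y) * H X Y) ⟩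
    (sumPairs (λ X Y → χ (glues V₁ V₂ X Y) * H (true ∷ X) (true ∷ Y)) + unglued true false)
      + (unglued false true + sumPairs (λ X Y → χ (glues V₁ V₂ X Y) * H (false ∷ X) (false ∷ Y)))
      ≈⟨ +-cong (≈-trans (+-congˡ vanish) (+-identityʳ _)) (≈-trans (+-congʳ vanish) (+-identityˡ _)) ⟩
    sumPairs (λ X Y → χ (glues V₁ V₂ X Y) * H (true ∷ X) (true ∷ Y))
      + sumPairs (λ X Y → χ (glues V₁ V₂ X Y) * H (false ∷ X) (false ∷ Y))
      ≈⟨ +-cong (glue-sum V₁ V₂ (λ u → cov (suc u)) _) (glue-sum V₁ V₂ (λ u → cov (suc u)) _) ⟩
    _ ≈⟨ sumSubsets-suc {n} (λ W → H (W ∩ (true ∷ V₁)) (W ∩ (true ∷ V₂))) ⟨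
    _ ∎
    where
    unglued : Bool → Bool → Carrier
    unglued b₁ b₂ = sumPairs {n} (λ X Y → 0# * H (b₁ ∷ X) (b₂ ∷ Y))
    vanish : ∀ {b₁ b₂} → unglued b₁ b₂ ≈ 0#
    vanish = sumPairs-zero {n} (λ X Y → zeroˡ _)
  glue-sum {suc n} (true ∷ V₁) (false ∷ V₂) cov H = begin
    _ ≈⟨ sumPairs-suc {n} (λ X Y → χ (glues (true ∷ V₁) (false ∷ V₂) X Y) * H X Y) ⟩
    (unglued true true + sumPairs (λ X Y → χ (glues V₁ V₂ X Y) * H (true ∷ X) (false ∷ Y)))
      + (unglued false true + sumPairs (λ X Y → χ (glues V₁ V₂ X Y) * H (false ∷ X) (false ∷ Y)))
      ≈⟨ +-cong (≈-trans (+-congʳ vanish) (+-identityˡ _)) (≈-trans (+-congʳ vanish) (+-identityˡ _)) ⟩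
    sumPairs (λ X Y → χ (glues V₁ V₂ X Y) * H (true ∷ X) (false ∷ Y))
      + sumPairs (λ X Y → χ (glues V₁ V₂ X Y) * H (false ∷ X) (false ∷ Y))
      ≈⟨ +-cong (glue-sum V₁ V₂ (λ u → cov (suc u)) _) (glue-sum V₁ V₂ (λ u → cov (suc u)) _) ⟩
    _ ≈⟨ sumSubsets-suc {n} (λ W → H (W ∩ (true ∷ V₁)) (W ∩ (false ∷ V₂))) ⟨
    _ ∎
    where
    unglued : Bool → Bool → Carrier
    unglued b₁ b₂ = sumPairs {n} (λ X Y → 0# * H (b₁ ∷ X) (b₂ ∷ Y))
    vanish : ∀ {b₁ b₂} → unglued b₁ b₂ ≈ 0#
    vanish = sumPairs-zero {n} (λ X Y → zeroˡ _)
  glue-sum {suc n} (false ∷ V₁) (true ∷ V₂) cov H = begin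
    _ ≈⟨ sumPairs-suc {n} (λ X Y → χ (glues (false ∷ V₁) (true ∷ V₂) X Y) * H X Y) ⟩
    (unglued true true + unglued true false)
      + (sumPairs (λ X Y → χ (glues V₁ V₂ X Y) * H (false ∷ X) (true ∷ Y))
         + sumPairs (λ X Y → χ (glues V₁ V₂ X Y) * H (false ∷ X) (false ∷ Y)))
      ≈⟨ ≈-trans (+-congʳ (≈-trans (+-congʳ vanish) (+-identityˡ _))) (≈-trans (+-congʳ vanish) (+-identityˡ _)) ⟩
    sumPairs (λ X Y → χ (glues V₁ V₂ X Y) * H (false ∷ X) (true ∷ Y))
      + sumPairs (λ X Y → χ (glues V₁ V₂ X Y) * H (false ∷ X) (false ∷ Y))
      ≈⟨ +-cong (glue-sum V₁ V₂ (λ u → cov (suc u)) _) (glue-sum V₁ V₂ (λ u → cov (suc u)) _) ⟩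
    _ ≈⟨ sumSubsets-suc {n} (λ W → H (W ∩ (false ∷ V₁)) (W ∩ (true ∷ V₂))) ⟨
    _ ∎
    where
    unglued : Bool → Bool → Carrier
    unglued b₁ b₂ = sumPairs {n} (λ X Y → 0# * H (b₁ ∷ X) (b₂ ∷ Y))
    vanish : ∀ {b₁ b₂} → unglued b₁ b₂ ≈ 0#
    vanish = sumPairs-zero {n} (λ X Y → zeroˡ _)
  glue-sum (false ∷ V₁) (false ∷ V₂) cov H with cov zero
  ... | ()

module Expansion {c ℓ : Level} (R : CommutativeSemiring c ℓ) where
  open CommutativeSemiring R hiding (zero) renaming (refl to ≈-refl; sym to ≈-sym; trans to ≈-trans)
  open import Relation.Binary.Reasoning.Setoid setoid
  open import Algebra.Solver.Ring.NaturalCoefficients.Default R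
  open Sums R

  qForm : Carrier → (Fin 3 → Carrier) → (Fin 3 → Carrier) → Carrier
  qForm x a b = a zero * b zero + (a zero * b (suc zero) + (a (suc zero) * b zero
              + x * (a (suc (suc zero)) * b (suc (suc zero)))))

  bilin-Q : ∀ x a b → bilin R a (Qmat R x) b ≈ qForm x a b
  bilin-Q x a b = solve 7 (λ x a₀ a₁ a₂ b₀ b₁ b₂ →
      (a₀ :* (con 1 :* b₀) :+ (a₀ :* (con 1 :* b₁) :+ a₀ :* (con 0 :* b₂)))
      :+ ((a₁ :* (con 1 :* b₀) :+ (a₁ :* (con 0 :* b₁) :+ a₁ :* (con 0 :* b₂)))
      :+ (a₂ :* (con 0 :* b₀) :+ (a₂ :* (con 0 :* b₁) :+ a₂ :* (x :* b₂))))
    := a₀ :* b₀ :+ (a₀ :* b₁ :+ (a₁ :* b₀ :+ x :* (a₂ :* b₂)))) ≈-refl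
    x (a zero) (a (suc zero)) (a (suc (suc zero))) (b zero) (b (suc zero)) (b (suc (suc zero)))

  qForm-cong : ∀ x {a a′ b b′} → (∀ i → a i ≈ a′ i) → (∀ j → b j ≈ b′ j) → qForm x a b ≈ qForm x a′ b′
  qForm-cong x ea eb = +-cong (*-cong (ea zero) (eb zero)) (+-cong (*-cong (ea zero) (eb (suc zero)))
    (+-cong (*-cong (ea (suc zero)) (eb zero)) (*-congˡ (*-cong (ea (suc (suc zero))) (eb (suc (suc zero)))))))

  -- Q only pairs entries that agree on whether v is present.
  qForm-vanish : ∀ x a b → (∀ i j → containsV i ≡ containsV j → a i * b j ≈ 0#) → qForm x a b ≈ 0#
  qForm-vanish x a b h = ≈-trans
    (+-cong (h zero zero refl) (+-cong (h zero (suc zero) refl)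
      (+-cong (h (suc zero) zero refl) (*-congˡ (h (suc (suc zero)) (suc (suc zero)) refl)))))
    (solve 1 (λ x → con 0 :+ (con 0 :+ (con 0 :+ x :* con 0)) := con 0) ≈-refl x)

  qForm-sums : ∀ {n} x (g h : Subset n → Fin 3 → Carrier) →
    qForm x (λ i → sumSubsets (λ X → g X i)) (λ j → sumSubsets (λ Y → h Y j))
      ≈ sumPairs (λ X Y → qForm x (g X) (h Y))
  qForm-sums {n} x g h = begin
    qForm x (λ i → sumSubsets (λ X → g X i)) (λ j → sumSubsets (λ Y → h Y j))
      ≈⟨ +-cong (entry zero zero) (+-cong (entry zero (suc zero))
           (+-cong (entry (suc zero) zero) (*-congˡ (entry (suc (suc zero)) (suc (suc zero)))))) ⟩
    sumPairs k₀₀ + (sumPairs k₀₁ + (sumPairs k₁₀ + x * sumPairs k₂₂))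
      ≈⟨ +-congˡ (+-congˡ (+-congˡ (sumPairs-*ˡ x k₂₂))) ⟨
    sumPairs k₀₀ + (sumPairs k₀₁ + (sumPairs k₁₀ + sumPairs xk₂₂))
      ≈⟨ +-congˡ (+-congˡ (sumPairs-+ k₁₀ xk₂₂)) ⟨
    sumPairs k₀₀ + (sumPairs k₀₁ + sumPairs (λ X Y → k₁₀ X Y + xk₂₂ X Y))
      ≈⟨ +-congˡ (sumPairs-+ k₀₁ (λ X Y → k₁₀ X Y + xk₂₂ X Y)) ⟨
    sumPairs k₀₀ + sumPairs (λ X Y → k₀₁ X Y + (k₁₀ X Y + xk₂₂ X Y))
      ≈⟨ sumPairs-+ k₀₀ (λ X Y → k₀₁ X Y + (k₁₀ X Y + xk₂₂ X Y)) ⟨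
    sumPairs (λ X Y → qForm x (g X) (h Y)) ∎
    where
    k : Fin 3 → Fin 3 → Subset n → Subset n → Carrier
    k i j X Y = g X i * h Y j
    k₀₀ k₀₁ k₁₀ k₂₂ xk₂₂ : Subset n → Subset n → Carrier
    k₀₀ = k zero zero
    k₀₁ = k zero (suc zero)
    k₁₀ = k (suc zero) zero
    k₂₂ = k (suc (suc zero)) (suc (suc zero))
    xk₂₂ X Y = x * k₂₂ X Y
    entry : ∀ i j → sumSubsets (λ X → g X i) * sumSubsets (λ Y → h Y j) ≈ sumPairs (k i j)
    entry i j = sumSubsets-product (λ X → g X i) (λ Y → h Y j)

  uTerm : ∀ {n} → Subset n → Adj n → Fin n → Carrier → Subset n → Fin 3 → Carrier
  uTerm S A v x X i = χ (contributes S A v i X) * pow R x (exponentAt i ∣ X ∣)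

  uVec-as-sum : ∀ {n} (S : Subset n) A v x i → uVec R S A v x i ≈ sumSubsets (λ X → uTerm S A v x X i)
  uVec-as-sum S A v x zero = sumOver-as-sum (contributes S A v zero) (idℕ R) x
  uVec-as-sum S A v x (suc zero) = sumOver-as-sum (contributes S A v (suc zero)) (idℕ R) x
  uVec-as-sum S A v x (suc (suc zero)) = sumOver-as-sum (contributes S A v (suc (suc zero))) (λ k → k ∸ 1) x

  sideTerms : Carrier → Bool → Bool → Bool → ℕ → Fin 3 → Carrier
  sideTerms x a b m k i = χ (sideCondition a b m i) * pow R x (exponentAt i k)

  uTerm-decomposed : ∀ {n} {S : Subset n} {A : Adj n} {v X} x → Symmetric A → SubsetOf X S →
    mem v S ≡ true → ∀ i →
    uTerm S A v x X i ≡ sideTerms x (dominatesExcept S A v X) (inClosedNbhd A X v) (mem v X) ∣ X ∣ i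
  uTerm-decomposed {X = X} x A-sym X⊆S v∈S i =
    cong (λ c → χ c * pow R x (exponentAt i ∣ X ∣)) (contributes-decomposed A-sym X⊆S v∈S i)

  uTerm-unglued : ∀ {n} {E : Adj n} {V₁ E₁ V₂ E₂ v} → IsArticulationSplitting E V₁ E₁ V₂ E₂ v →
    ∀ x {X Y} → glues V₁ V₂ X Y ≡ false → qForm x (uTerm V₁ E₁ v x X) (uTerm V₂ E₂ v x Y) ≈ 0#
  uTerm-unglued {V₁ = V₁} {E₁} {V₂} {E₂} {v} split x {X} {Y} unglued =
    qForm-vanish x _ _ (λ i j same → χ-exclusive (incompatible i j same)
      (pow R x (exponentAt i ∣ X ∣)) (pow R x (exponentAt j ∣ Y ∣)))
    where
    incompatible : ∀ i j → containsV i ≡ containsV j →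
      contributes V₁ E₁ v i X ≡ true → contributes V₂ E₂ v j Y ≡ true → ⊥
    incompatible i j same p q with contributes-support {S = V₁} {E₁} {v} {X} i p
                                 | contributes-support {S = V₂} {E₂} {v} {Y} j q
    ... | X⊆V₁ , vX | Y⊆V₂ , vY =
      not-¬ (glues-intro split X⊆V₁ Y⊆V₂ (trans vX (trans same (sym vY)))) unglued

  glue-indicator : ∀ {n} {E : Adj n} {V₁ E₁ V₂ E₂ v} → IsArticulationSplitting E V₁ E₁ V₂ E₂ v →
    ∀ x X Y → χ (glues V₁ V₂ X Y) * qForm x (uTerm V₁ E₁ v x X) (uTerm V₂ E₂ v x Y)
              ≈ qForm x (uTerm V₁ E₁ v x X) (uTerm V₂ E₂ v x Y)
  glue-indicator {V₁ = V₁} {V₂ = V₂} split x X Y with glues V₁ V₂ X Y in glued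
  ... | true = *-identityˡ _
  ... | false = ≈-trans (zeroˡ _) (≈-sym (uTerm-unglued split x glued))

  -- Dominated on at least one side = on both, or on exactly one of them.
  χ-split : ∀ a₁ b₁ a₂ b₂ → χ ((a₁ ∧ a₂) ∧ (b₁ ∨ b₂)) ≈
    χ (a₁ ∧ b₁) * χ (a₂ ∧ b₂) + (χ (a₁ ∧ b₁) * χ (a₂ ∧ not b₂) + χ (a₁ ∧ not b₁) * χ (a₂ ∧ b₂))
  χ-split a₁ b₁ a₂ b₂ = begin
    χ ((a₁ ∧ a₂) ∧ (b₁ ∨ b₂))
      ≈⟨ ≈-trans (χ-∧ (a₁ ∧ a₂) (b₁ ∨ b₂)) (*-cong (χ-∧ a₁ a₂) (χ-∨ b₁ b₂)) ⟩
    (χ a₁ * χ a₂) * (χ b₁ * χ b₂ + (χ b₁ * χ (not b₂) + χ (not b₁) * χ b₂))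
      ≈⟨ solve 6 (λ A₁ A₂ B₁ B₂ B̄₁ B̄₂ → (A₁ :* A₂) :* (B₁ :* B₂ :+ (B₁ :* B̄₂ :+ B̄₁ :* B₂))
           := (A₁ :* B₁) :* (A₂ :* B₂) :+ ((A₁ :* B₁) :* (A₂ :* B̄₂) :+ (A₁ :* B̄₁) :* (A₂ :* B₂)))
           ≈-refl (χ a₁) (χ a₂) (χ b₁) (χ b₂) (χ (not b₁)) (χ (not b₂)) ⟩
    (χ a₁ * χ b₁) * (χ a₂ * χ b₂) + ((χ a₁ * χ b₁) * (χ a₂ * χ (not b₂)) + (χ a₁ * χ (not b₁)) * (χ a₂ * χ b₂))
      ≈⟨ +-cong (*-cong (χ-∧ a₁ b₁) (χ-∧ a₂ b₂))
           (+-cong (*-cong (χ-∧ a₁ b₁) (χ-∧ a₂ (not b₂))) (*-cong (χ-∧ a₁ (not b₁)) (χ-∧ a₂ b₂))) ⟨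
    χ (a₁ ∧ b₁) * χ (a₂ ∧ b₂) + (χ (a₁ ∧ b₁) * χ (a₂ ∧ not b₂) + χ (a₁ ∧ not b₁) * χ (a₂ ∧ b₂)) ∎

  -- v ∉ W: then |W| = k₁ + k₂, and the last entries vanish.
  local-out : ∀ x a₁ b₁ a₂ b₂ k₁ k₂ → χ ((a₁ ∧ a₂) ∧ (b₁ ∨ b₂)) * pow R x (k₁ ℕ.+ k₂)
    ≈ qForm x (sideTerms x a₁ b₁ false k₁) (sideTerms x a₂ b₂ false k₂)
  local-out x a₁ b₁ a₂ b₂ k₁ k₂ = ≈-trans (*-cong (χ-split a₁ b₁ a₂ b₂) (pow-+ x k₁ k₂))
    (solve 9 (λ x C₁ C₂ D₁ D₂ p₁ p₂ q₁ q₂ →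
        (C₁ :* D₁ :+ (C₁ :* D₂ :+ C₂ :* D₁)) :* (p₁ :* p₂)
      := (C₁ :* p₁) :* (D₁ :* p₂) :+ ((C₁ :* p₁) :* (D₂ :* p₂)
         :+ ((C₂ :* p₁) :* (D₁ :* p₂) :+ x :* ((con 0 :* q₁) :* (con 0 :* q₂))))) ≈-refl
      x (χ (a₁ ∧ b₁)) (χ (a₁ ∧ not b₁)) (χ (a₂ ∧ b₂)) (χ (a₂ ∧ not b₂))
      (pow R x k₁) (pow R x k₂) (pow R x (k₁ ∸ 1)) (pow R x (k₂ ∸ 1)))

  -- v ∈ W: v is counted in both traces, so |W| + 1 = k₁ + k₂, and only
  -- the last entries survive.
  local-in : ∀ x a₁ a₂ k {k₁ k₂} → 1 ≤ k₁ → 1 ≤ k₂ → k₁ ℕ.+ k₂ ≡ k ℕ.+ 1 →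
    χ ((a₁ ∧ a₂) ∧ true) * pow R x k ≈ qForm x (sideTerms x a₁ true true k₁) (sideTerms x a₂ true true k₂)
  local-in x a₁ a₂ k {suc j₁} {suc j₂} (s≤s z≤n) (s≤s z≤n) sizes = ≈-trans (*-cong indicator power)
    (solve 7 (λ x A₁ A₂ p₁ p₂ q₁ q₂ →
        (A₁ :* A₂) :* (x :* (q₁ :* q₂))
      := (con 0 :* p₁) :* (con 0 :* p₂) :+ ((con 0 :* p₁) :* (con 0 :* p₂)
         :+ ((con 0 :* p₁) :* (con 0 :* p₂) :+ x :* ((A₁ :* q₁) :* (A₂ :* q₂))))) ≈-refl
      x (χ (a₁ ∧ true)) (χ (a₂ ∧ true)) (pow R x (suc j₁)) (pow R x (suc j₂)) (pow R x j₁) (pow R x j₂))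
    where
    χ-∧-true : ∀ a → χ (a ∧ true) ≡ χ a
    χ-∧-true a = cong χ (∧-identityʳ a)
    indicator : χ ((a₁ ∧ a₂) ∧ true) ≈ χ (a₁ ∧ true) * χ (a₂ ∧ true)
    indicator = ≈-trans (reflexive (χ-∧-true (a₁ ∧ a₂)))
      (≈-trans (χ-∧ a₁ a₂) (reflexive (sym (cong₂ _*_ (χ-∧-true a₁) (χ-∧-true a₂)))))
    size : k ≡ suc (j₁ ℕ.+ j₂)
    size = sym (trans (sym (ℕₚ.+-suc j₁ j₂)) (ℕₚ.suc-injective (trans sizes (ℕₚ.+-comm k 1))))
    power : pow R x k ≈ x * (pow R x j₁ * pow R x j₂)
    power = ≈-trans (reflexive (cong (pow R x) size)) (*-congˡ (pow-+ x j₁ j₂))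

  local-identity : ∀ x a₁ b₁ a₂ b₂ m k k₁ k₂ →
    (m ≡ true → b₁ ≡ true × b₂ ≡ true × 1 ≤ k₁ × 1 ≤ k₂) →
    k₁ ℕ.+ k₂ ≡ k ℕ.+ (if m then 1 else 0) →
    χ ((a₁ ∧ a₂) ∧ (b₁ ∨ b₂)) * pow R x k ≈ qForm x (sideTerms x a₁ b₁ m k₁) (sideTerms x a₂ b₂ m k₂)
  local-identity x a₁ b₁ a₂ b₂ false k k₁ k₂ _ sizes =
    ≈-trans (*-congˡ (reflexive (cong (pow R x) (sym (trans sizes (ℕₚ.+-identityʳ k))))))
            (local-out x a₁ b₁ a₂ b₂ k₁ k₂)
  local-identity x a₁ b₁ a₂ b₂ true k k₁ k₂ inside sizes with inside refl
  ... | refl , refl , 1≤k₁ , 1≤k₂ = local-in x a₁ a₂ k 1≤k₁ 1≤k₂ sizes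

  pointwise : ∀ {n} {E : Adj n} {V₁ E₁ V₂ E₂ v} → IsArticulationSplitting E V₁ E₁ V₂ E₂ v →
    ∀ x W → χ (dominates ⊤ E W) * pow R x ∣ W ∣
            ≈ qForm x (uTerm V₁ E₁ v x (W ∩ V₁)) (uTerm V₂ E₂ v x (W ∩ V₂))
  pointwise {E = E} {V₁} {E₁} {V₂} {E₂} {v} split x W = begin
    χ (dominates ⊤ E W) * pow R x ∣ W ∣
      ≡⟨ cong (λ d → χ d * pow R x ∣ W ∣) (dominates-glued split W) ⟩
    χ ((a split ∧ a (swap split)) ∧ (b split ∨ b (swap split))) * pow R x ∣ W ∣
      ≈⟨ local-identity x (a split) (b split) (a (swap split)) (b (swap split)) (mem v W)
           (∣ W ∣) (∣ W ∩ V₁ ∣) (∣ W ∩ V₂ ∣) v∈W (trace-sizes split W) ⟩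
    qForm x (side split) (side (swap split))
      ≈⟨ qForm-cong x (λ i → reflexive (decomposed split i)) (λ i → reflexive (decomposed (swap split) i)) ⟨
    qForm x (uTerm V₁ E₁ v x (W ∩ V₁)) (uTerm V₂ E₂ v x (W ∩ V₂)) ∎
    where
    module _ {V E′ V′ E″} (s : IsArticulationSplitting E V E′ V′ E″ v) where
      a b : Bool
      a = dominatesExcept V E′ v (W ∩ V)
      b = inClosedNbhd E′ (W ∩ V) v
      v∈trace : mem v (W ∩ V) ≡ mem v W
      v∈trace = mem-trace W V (v∈V₁ s)
      side : Fin 3 → Carrier
      side = sideTerms x a b (mem v W) ∣ W ∩ V ∣
      decomposed : ∀ i → uTerm V E′ v x (W ∩ V) i ≡ side i
      decomposed i = trans (uTerm-decomposed x (E₁-sym s) (trace-⊆ W V) (v∈V₁ s) i)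
                           (cong (λ m → sideTerms x a b m ∣ W ∩ V ∣ i) v∈trace)
      v-in-trace : mem v W ≡ true → b ≡ true × 1 ≤ ∣ W ∩ V ∣
      v-in-trace h = ∨-introˡ (trans v∈trace h) , nonempty-size (W ∩ V) (trans v∈trace h)
    v∈W : mem v W ≡ true → b split ≡ true × b (swap split) ≡ true × 1 ≤ ∣ W ∩ V₁ ∣ × 1 ≤ ∣ W ∩ V₂ ∣
    v∈W h = proj₁ (v-in-trace split h) , proj₁ (v-in-trace (swap split) h)
          , proj₂ (v-in-trace split h) , proj₂ (v-in-trace (swap split) h)

mainTheorem8 : ∀ {c ℓ : Level} (R : CommutativeSemiring c ℓ) (n : ℕ)
    (E : Adj n) → Symmetric E → Irreflexive E →
    (V₁ : Subset n) (E₁ : Adj n) (V₂ : Subset n) (E₂ : Adj n) (v : Fin n) →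
    IsArticulationSplitting E V₁ E₁ V₂ E₂ v →
    (x : CommutativeSemiring.Carrier R) →
    CommutativeSemiring._≈_ R (Dom R ⊤ E x)
    (bilin R (uVec R V₁ E₁ v x) (Qmat R x) (uVec R V₂ E₂ v x))
mainTheorem8 R n E _ _ V₁ E₁ V₂ E₂ v split x = begin
  Dom R ⊤ E x
    ≈⟨ sumOver-as-sum (dominates ⊤ E) (idℕ R) x ⟩
  sumSubsets (λ W → χ (dominates ⊤ E W) * pow R x ∣ W ∣)
    ≈⟨ sumList-cong (subsets n) (pointwise split x) ⟩
  sumSubsets (λ W → qForm x (u₁ (W ∩ V₁)) (u₂ (W ∩ V₂)))
    ≈⟨ glue-sum V₁ V₂ (cover split) (λ X Y → qForm x (u₁ X) (u₂ Y)) ⟨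
  sumPairs (λ X Y → χ (glues V₁ V₂ X Y) * qForm x (u₁ X) (u₂ Y))
    ≈⟨ sumPairs-cong (glue-indicator split x) ⟩
  sumPairs (λ X Y → qForm x (u₁ X) (u₂ Y))
    ≈⟨ qForm-sums x u₁ u₂ ⟨
  qForm x (λ i → sumSubsets (λ X → u₁ X i)) (λ j → sumSubsets (λ Y → u₂ Y j))
    ≈⟨ qForm-cong x (uVec-as-sum V₁ E₁ v x) (uVec-as-sum V₂ E₂ v x) ⟨
  qForm x (uVec R V₁ E₁ v x) (uVec R V₂ E₂ v x)
    ≈⟨ bilin-Q x (uVec R V₁ E₁ v x) (uVec R V₂ E₂ v x) ⟨
  bilin R (uVec R V₁ E₁ v x) (Qmat R x) (uVec R V₂ E₂ v x) ∎
  where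
  open Sums R
  open Expansion R
  open CommutativeSemiring R using (setoid; _*_)
  open import Relation.Binary.Reasoning.Setoid setoid
  u₁ u₂ : Subset n → Fin 3 → CommutativeSemiring.Carrier R
  u₁ = uTerm V₁ E₁ v x
  u₂ = uTerm V₂ E₂ v x
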